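{- Let $q$ be a prime power, $n$ a positive integer, $q'$ the square-free part of $q^n-1$, and $r\mid q'$. Let $r_0,r_1,\ldots,r_t$ be divisors of $r$ such that $\gcd(r_i,r_j)=r_0$ for all $1\leq i<j\leq t$ and $\mathrm{lcm}(r_1,\ldots,r_t)=r$. Then \[ \mathrm{CN}_q^r(n)\geq\sum_{i=1}^t\mathrm{CN}_q^{r_i}(n)-(t-1)\,\mathrm{CN}_q^{r_0}(n). \]
   Context: For $s\mid q^n-1$, $x\in\mathbb{F}_{q^n}$ is $s$-free if $x=y^d$ with $d\mid s$ and $y\in\mathbb{F}_{q^n}$ implies $d=1$. For a divisor $l$ of $n$, $x\in\mathbb{F}_{q^n}$ is normal over $\mathbb{F}_{q^l}$ if $\{x, x^{q^l},\ldots,x^{q^{l(n/l-1)}}\}$ is an $\mathbb{F}_{q^l}$-basis of $\mathbb{F}_{q^n}$; $x$ is completely normal over $\mathbb{F}_q$ if it is normal over $\mathbb{F}_{q^l}$ for every positive divisor $l$ of $n$. $\mathrm{CN}_q^s(n)$ denotes the number of $s$-free elements of $\mathbb{F}_{q^n}$ that are completely normal over $\mathbb{F}_q$. -}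

module Defs where

open import Level using (0ℓ)
open import Algebra.Bundles using (CommutativeRing)
open import Data.Nat using (ℕ; zero; suc; _≥_) renaming (_*_ to _*ℕ_; _^_ to _^ℕ_; _+_ to _+ℕ_)
open import Data.Nat.Divisibility using (_∣_)
open import Data.Nat.Primality using (Prime)
open import Data.Nat.LCM using (lcm)
open import Data.Fin using (Fin)
open import Data.Product using (Σ; ∃; _×_; _,_; proj₁)
open import Relation.Nullary using (¬_)
open import Relation.Binary.PropositionalEquality using (_≡_)
open import Relation.Binary.Bundles using (Setoid)
open import Function.Bundles using (Bijection)
import Relation.Binary.PropositionalEquality as PE

IsPrimePower : ℕ → Set
IsPrimePower q = Σ ℕ λ p → Σ ℕ λ k → Prime p × k ≥ 1 × q ≡ p ^ℕ k

SquareFree : ℕ → Set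
SquareFree m = ∀ p → Prime p → ¬ (p *ℕ p ∣ m)

-- q' is the square-free part (radical) of m: the product of the
-- distinct primes dividing m, characterised as the square-free divisor
-- of m divisible by every prime divisor of m.
IsSquareFreePart : ℕ → ℕ → Set
IsSquareFreePart m q' = SquareFree q' × q' ∣ m × (∀ p → Prime p → p ∣ m → p ∣ q')

sumℕ : (t : ℕ) → (Fin t → ℕ) → ℕ
sumℕ zero    f = 0
sumℕ (suc t) f = f Fin.zero +ℕ sumℕ t (λ i → f (Fin.suc i))
  where import Data.Fin as Fin

lcmFam : (t : ℕ) → (Fin t → ℕ) → ℕ
lcmFam zero    f = 1
lcmFam (suc t) f = lcm (f Fin.zero) (lcmFam t (λ i → f (Fin.suc i)))
  where import Data.Fin as Fin

module FieldDefs (R : CommutativeRing 0ℓ 0ℓ) where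
  open CommutativeRing R

  pow : Carrier → ℕ → Carrier
  pow x zero    = 1#
  pow x (suc k) = x * pow x k

  IsField : Set
  IsField = (¬ (0# ≈ 1#)) × (∀ x → ¬ (x ≈ 0#) → ∃ λ y → x * y ≈ 1#)

  HasOrder : ℕ → Set
  HasOrder N = Bijection (PE.setoid (Fin N)) setoid

  sumF : (m : ℕ) → (Fin m → Carrier) → Carrier
  sumF zero    f = 0#
  sumF (suc m) f = f Fin.zero + sumF m (λ i → f (Fin.suc i))
    where import Data.Fin as Fin

  open import Data.Fin using (toℕ)

  Free : ℕ → Carrier → Set
  Free s x = ∀ (d : ℕ) (y : Carrier) → d ∣ s → x ≈ pow y d → d ≡ 1

  InSubfield : ℕ → ℕ → Carrier → Set
  InSubfield q l c = pow c (q ^ℕ l) ≈ c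

  conj : ℕ → ℕ → Carrier → ℕ → Carrier
  conj q l x i = pow x (q ^ℕ (l *ℕ i))

  -- x is normal over F_{q^l}, where n = m·l: the elements
  -- x, x^(q^l), …, x^(q^(l(m-1))) form an F_{q^l}-basis of the field
  -- (linearly independent over F_{q^l} and spanning over F_{q^l}).
  NormalOver : ℕ → ℕ → ℕ → Carrier → Set
  NormalOver q l m x =
    (∀ (c : Fin m → Carrier) → (∀ i → InSubfield q l (c i)) →
       sumF m (λ i → c i * conj q l x (toℕ i)) ≈ 0# → ∀ i → c i ≈ 0#)
    × (∀ (y : Carrier) → ∃ λ (c : Fin m → Carrier) →
       (∀ i → InSubfield q l (c i)) × y ≈ sumF m (λ i → c i * conj q l x (toℕ i)))

  CompletelyNormal : ℕ → ℕ → Carrier → Set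
  CompletelyNormal q n x = ∀ (l m : ℕ) → m *ℕ l ≡ n → NormalOver q l m x

  CNPred : ℕ → ℕ → ℕ → Carrier → Set
  CNPred q n s x = Free s x × CompletelyNormal q n x

  subSetoid : (Carrier → Set) → Setoid 0ℓ 0ℓ
  subSetoid P = record
    { Carrier = Σ Carrier P
    ; _≈_ = λ a b → proj₁ a ≈ proj₁ b
    ; isEquivalence = record { refl = refl ; sym = sym ; trans = trans } }

  HasCard : (Carrier → Set) → ℕ → Set
  HasCard P k = Bijection (PE.setoid (Fin k)) (subSetoid P)

  CNIs : ℕ → ℕ → ℕ → ℕ → Set
  CNIs q n s k = HasCard (CNPred q n s) k

module Submission where

-- Enumerate the k₀ completely normal r₀-free elements x₁, …, x_{k₀}. Every
-- rᵢ is a multiple of r₀, so an rᵢ-free element is r₀-free and kᵢ is the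
-- number of xⱼ that are rᵢ-free. Conversely an element that is rᵢ-free for
-- every i is free for lcm(r₁, …, r_t) = r. Hence for each j
--   #{i | xⱼ is rᵢ-free} + 1 ≤ [xⱼ is r-free] + t,
-- and summing over j gives Σᵢ kᵢ + k₀ ≤ k + t·k₀, which is the claim.
-- Counting is done constructively, so s-freeness must be decidable: it is
-- for s ≠ 0 in a finite ring, and r ≠ 0 because r divides qⁿ − 1 ≠ 0.

open import Defs
open import Level using (0ℓ)
open import Algebra.Bundles using (CommutativeRing)
open import Data.Fin.Base using (Fin)
open import Data.Nat.Base using (ℕ)

module DivisibilityFacts where
  open import Data.Fin.Base using (toℕ; fromℕ<) renaming (zero to fzero; suc to fsuc)
  open import Data.Fin.Properties using (all?; toℕ-fromℕ<)
  open import Data.Nat.Base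
    using (zero; suc; _^_; _∸_; _≤_; _<_; _≥_; s≤s; z≤n; NonZero; >-nonZero; nonTrivial⇒n>1)
  open import Data.Nat.Properties using (*-mono-≤; m^n>0; m∸n≡0⇒m≤n; ≤-trans)
  open import Data.Nat.Divisibility
    using (_∣_; _∣?_; divides; ∣-trans; ∣-refl; 1∣_; ∣1⇒≡1; ∣⇒≤; m∣m*n; n∣m*n; 0∣⇒≡0)
  open import Data.Nat.GCD using (gcd; gcd[m,n]∣m)
  open import Data.Nat.LCM using (lcm; lcm-least)
  open import Data.Nat.Primality using (Prime; euclidsLemma; ¬prime[1]; prime[2]; prime⇒nonTrivial)
  open import Data.Nat.Primality.Factorisation using (factorise)
  open import Data.List.Base using ([]; _∷_)
  open import Data.Nat.ListAction using (product)
  open import Data.List.Relation.Unary.All using (_∷_)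
  open import Data.Product using (∃; _×_; _,_; map)
  open import Data.Sum using (_⊎_; inj₁; inj₂)
  open import Function.Base using (_∘_; id)
  open import Relation.Nullary using (¬_; Dec; contradiction)
  open import Relation.Nullary.Decidable using (map′; _→-dec_)
  open import Relation.Binary.PropositionalEquality using (_≡_; _≢_; refl; sym; subst)

  -- A prime dividing lcm(a, b) divides a or b, since lcm(a, b) ∣ a·b.
  prime∣lcm : ∀ {p} a b → Prime p → p ∣ lcm a b → p ∣ a ⊎ p ∣ b
  prime∣lcm a b p-prime p∣lcm =
    euclidsLemma a b p-prime (∣-trans p∣lcm (lcm-least {a} (m∣m*n b) (n∣m*n a)))

  prime∣lcmFam : ∀ {p} t (rs : Fin t → ℕ) → Prime p → p ∣ lcmFam t rs → ∃ λ i → p ∣ rs i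
  prime∣lcmFam zero rs p-prime p∣1 = contradiction (subst Prime (∣1⇒≡1 p∣1) p-prime) ¬prime[1]
  prime∣lcmFam (suc t) rs p-prime p∣lcm with prime∣lcm (rs fzero) (lcmFam t (rs ∘ fsuc)) p-prime p∣lcm
  ... | inj₁ p∣r₁ = fzero , p∣r₁
  ... | inj₂ p∣rest = map fsuc id (prime∣lcmFam t (rs ∘ fsuc) p-prime p∣rest)

  prime-divisor : ∀ d → d ≢ 1 → ∃ λ p → Prime p × p ∣ d
  prime-divisor zero _ = 2 , prime[2] , divides 0 refl
  prime-divisor (suc d) d≢1 with factorise (suc d)
  ... | record { factors = [] ; isFactorisation = d≡1 } = contradiction d≡1 d≢1
  ... | record { factors = p ∷ ps ; isFactorisation = d≡pps ; factorsPrime = p-prime ∷ _ } =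
    p , p-prime , subst (p ∣_) (sym d≡pps) (m∣m*n (product ps))

  -- If gcd(rᵢ, rⱼ) = r₀ for i ≠ j, r₀ ∣ r and r = lcm(r₁, …, r_t), then r₀
  -- divides every rᵢ: for t ≥ 2 pick any j ≠ i, for t = 1 use r = lcm(r₁, 1) ∣ r₁.
  common-divisor : ∀ t (rs : Fin t → ℕ) {r r₀} → r₀ ∣ r →
    (∀ i j → ¬ (i ≡ j) → gcd (rs i) (rs j) ≡ r₀) → lcmFam t rs ≡ r → ∀ i → r₀ ∣ rs i
  common-divisor (suc zero) rs r₀∣r _ lcm≡r fzero =
    ∣-trans r₀∣r (subst (_∣ rs fzero) lcm≡r (lcm-least ∣-refl (1∣ rs fzero)))
  common-divisor (suc (suc t)) rs _ gcd≡r₀ _ i =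
    subst (_∣ rs i) (gcd≡r₀ i (other i) (other≢ i)) (gcd[m,n]∣m (rs i) (rs (other i)))
    where
    other : Fin (suc (suc t)) → Fin (suc (suc t))
    other fzero    = fsuc fzero
    other (fsuc _) = fzero
    other≢ : ∀ i → ¬ (i ≡ other i)
    other≢ fzero    ()
    other≢ (fsuc _) ()

  divisor-nonzero : ∀ {d m} → d ∣ m → m ≢ 0 → d ≢ 0
  divisor-nonzero d∣m m≢0 refl = m≢0 (0∣⇒≡0 d∣m)

  -- qⁿ − 1 ≠ 0 for a prime power q and n ≥ 1, because then qⁿ ≥ 2.
  prime-power-pred≢0 : ∀ {q n} → IsPrimePower q → n ≥ 1 → q ^ n ∸ 1 ≢ 0
  prime-power-pred≢0 {q} {n} (p , e , p-prime , e≥1 , refl) n≥1 qⁿ∸1≡0 =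
    contradiction (≤-trans 2≤qⁿ (m∸n≡0⇒m≤n {q ^ n} {1} qⁿ∸1≡0)) λ { (s≤s ()) }
    where
    2≤m^n : ∀ {m k} → 2 ≤ m → k ≥ 1 → 2 ≤ m ^ k
    2≤m^n {m} {suc k} 2≤m _ = *-mono-≤ 2≤m (m^n>0 m {{>-nonZero (≤-trans (s≤s z≤n) 2≤m)}} k)
    2≤qⁿ : 2 ≤ q ^ n
    2≤qⁿ = 2≤m^n (2≤m^n (nonTrivial⇒n>1 p {{prime⇒nonTrivial p-prime}}) e≥1) n≥1

  all-divisors? : ∀ s .{{_ : NonZero s}} {Q : ℕ → Set} →
    (∀ d → Dec (Q d)) → Dec (∀ d → d ∣ s → Q d)
  all-divisors? s {Q} Q? = map′ unbounded bounded (all? λ d → (toℕ d ∣? s) →-dec Q? (toℕ d))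
    where
    bounded : (∀ d → d ∣ s → Q d) → ∀ (d : Fin (suc s)) → toℕ d ∣ s → Q (toℕ d)
    bounded h d = h (toℕ d)
    unbounded : (∀ (d : Fin (suc s)) → toℕ d ∣ s → Q (toℕ d)) → ∀ d → d ∣ s → Q d
    unbounded h d d∣s =
      subst Q (toℕ-fromℕ< d<1+s) (h (fromℕ< d<1+s) (subst (_∣ s) (sym (toℕ-fromℕ< d<1+s)) d∣s))
      where
      d<1+s : d < suc s
      d<1+s = s≤s (∣⇒≤ d∣s)

module FinSums where
  open import Data.Fin.Base using () renaming (zero to fzero; suc to fsuc)
  open import Data.Nat.Base using (zero; suc; _+_; _*_; _≤_; z≤n)
  open import Data.Nat.Properties using (+-mono-≤; *-zeroʳ; +-commutativeSemigroup)
  open import Algebra.Properties.CommutativeSemigroup +-commutativeSemigroup using (interchange)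
  open import Function.Base using (_∘_)
  open import Relation.Binary.PropositionalEquality using (_≡_; refl; sym; trans; cong)
  open Relation.Binary.PropositionalEquality.≡-Reasoning

  sumℕ-mono : ∀ m {f g : Fin m → ℕ} → (∀ j → f j ≤ g j) → sumℕ m f ≤ sumℕ m g
  sumℕ-mono zero    f≤g = z≤n
  sumℕ-mono (suc m) f≤g = +-mono-≤ (f≤g fzero) (sumℕ-mono m (f≤g ∘ fsuc))

  sumℕ-+ : ∀ m (f g : Fin m → ℕ) → sumℕ m (λ j → f j + g j) ≡ sumℕ m f + sumℕ m g
  sumℕ-+ zero    f g = refl
  sumℕ-+ (suc m) f g = begin
    (f fzero + g fzero) + sumℕ m (λ j → f (fsuc j) + g (fsuc j))
      ≡⟨ cong (f fzero + g fzero +_) (sumℕ-+ m (λ j → f (fsuc j)) (λ j → g (fsuc j))) ⟩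
    (f fzero + g fzero) + (sumℕ m (λ j → f (fsuc j)) + sumℕ m (λ j → g (fsuc j)))
      ≡⟨ interchange (f fzero) (g fzero) _ _ ⟩
    (f fzero + sumℕ m (λ j → f (fsuc j))) + (g fzero + sumℕ m (λ j → g (fsuc j))) ∎

  sumℕ-const : ∀ m c → sumℕ m (λ _ → c) ≡ m * c
  sumℕ-const zero    c = refl
  sumℕ-const (suc m) c = cong (c +_) (sumℕ-const m c)

  sumℕ-swap : ∀ t m (f : Fin t → Fin m → ℕ) →
    sumℕ t (λ i → sumℕ m (f i)) ≡ sumℕ m (λ j → sumℕ t (λ i → f i j))
  sumℕ-swap zero    m f = sym (trans (sumℕ-const m 0) (*-zeroʳ m))
  sumℕ-swap (suc t) m f = begin
    sumℕ m (f fzero) + sumℕ t (λ i → sumℕ m (f (fsuc i)))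
      ≡⟨ cong (sumℕ m (f fzero) +_) (sumℕ-swap t m (f ∘ fsuc)) ⟩
    sumℕ m (f fzero) + sumℕ m (λ j → sumℕ t (λ i → f (fsuc i) j))
      ≡⟨ sym (sumℕ-+ m (f fzero) (λ j → sumℕ t (λ i → f (fsuc i) j))) ⟩
    sumℕ m (λ j → f fzero j + sumℕ t (λ i → f (fsuc i) j)) ∎

module BooleanCounting where
  open import Data.Bool.Base using (Bool; true; false; T)
  open import Data.Fin.Base using (toℕ; fromℕ<; punchOut) renaming (zero to fzero; suc to fsuc)
  open import Data.Fin.Properties
    using (all?; ¬∀⟶∃¬; injective⇒≤; toℕ-fromℕ<; punchOut-injective; suc-injective; <-cmp)
  open import Data.Nat.Base using (zero; suc; _+_; _*_; _≤_; _<_; z≤n; s≤s)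
  open import Data.Nat.Properties
    using (+-mono-≤; +-monoʳ-≤; +-monoʳ-<; m≤n+m; m≤n⇒m≤1+n; <⇒≢; +-comm; *-comm; *-identityʳ)
  import Data.Nat.Properties
  open import Data.Empty using (⊥-elim)
  open import Data.Product using (_,_)
  open import Function.Base using (_∘_)
  open import Relation.Binary.Definitions using (tri<; tri≈; tri>)
  open import Relation.Nullary using (¬_; yes; no; contradiction)
  open import Relation.Nullary.Decidable using (T?)
  open import Relation.Binary.PropositionalEquality using (_≡_; refl; sym; trans; cong; cong₂; subst)
  open FinSums

  ind : Bool → ℕ
  ind true  = 1
  ind false = 0

  count : (m : ℕ) → (Fin m → Bool) → ℕ
  count m b = sumℕ m (λ j → ind (b j))

  ind≤1 : ∀ x → ind x ≤ 1
  ind≤1 true  = s≤s z≤n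
  ind≤1 false = z≤n

  T⇒ind≡1 : ∀ {x} → T x → ind x ≡ 1
  T⇒ind≡1 {true} _ = refl

  true⇒0<ind+ : ∀ {x} n → T x → 0 < ind x + n
  true⇒0<ind+ {true} n _ = s≤s z≤n

  count≤ : ∀ m (b : Fin m → Bool) → count m b ≤ m
  count≤ zero    b = z≤n
  count≤ (suc m) b = +-mono-≤ (ind≤1 (b fzero)) (count≤ m (b ∘ fsuc))

  count< : ∀ m (b : Fin m → Bool) i → ¬ T (b i) → count m b < m
  count< (suc m) b fzero ¬b₀ with b fzero
  ... | true  = ⊥-elim (¬b₀ _)
  ... | false = s≤s (count≤ m (b ∘ fsuc))
  count< (suc m) b (fsuc i) ¬bᵢ with b fzero
  ... | true  = s≤s (count< m (b ∘ fsuc) i ¬bᵢ)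
  ... | false = m≤n⇒m≤1+n (count< m (b ∘ fsuc) i ¬bᵢ)

  rank : ∀ {m} → (Fin m → Bool) → Fin m → ℕ
  rank b fzero    = 0
  rank b (fsuc j) = ind (b fzero) + rank (b ∘ fsuc) j

  rank<count : ∀ {m} (b : Fin m → Bool) j → T (b j) → rank b j < count _ b
  rank<count b fzero    bⱼ = true⇒0<ind+ _ bⱼ
  rank<count b (fsuc j) bⱼ = +-monoʳ-< (ind (b fzero)) (rank<count (b ∘ fsuc) j bⱼ)

  rank-strict : ∀ {m} (b : Fin m → Bool) j j' → T (b j) → toℕ j < toℕ j' → rank b j < rank b j'
  rank-strict b fzero    (fsuc j') bⱼ _        = true⇒0<ind+ _ bⱼ
  rank-strict b (fsuc j) (fsuc j') bⱼ (s≤s j<j') = +-monoʳ-< (ind (b fzero)) (rank-strict (b ∘ fsuc) j j' bⱼ j<j')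

  rank-injective : ∀ {m} (b : Fin m → Bool) j j' → T (b j) → T (b j') → rank b j ≡ rank b j' → j ≡ j'
  rank-injective b j j' bⱼ bⱼ' eq with <-cmp j j'
  ... | tri< j<j' _ _ = contradiction eq (<⇒≢ (rank-strict b j j' bⱼ j<j'))
  ... | tri≈ _ j≡j' _ = j≡j'
  ... | tri> _ _ j'<j = contradiction (sym eq) (<⇒≢ (rank-strict b j' j bⱼ' j'<j))

  injection-≤-count : ∀ {k m} (b : Fin m → Bool) (f : Fin k → Fin m) →
    (∀ {x y} → f x ≡ f y → x ≡ y) → (∀ x → T (b (f x))) → k ≤ count m b
  injection-≤-count {k} {m} b f f-inj f-true = injective⇒≤ {f = position} position-inj
    where
    position : Fin k → Fin (count m b)
    position x = fromℕ< (rank<count b (f x) (f-true x))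
    position-inj : ∀ {x y} → position x ≡ position y → x ≡ y
    position-inj {x} {y} eq = f-inj (rank-injective b (f x) (f y) (f-true x) (f-true y) (begin
      rank b (f x)      ≡⟨ sym (toℕ-fromℕ< (rank<count b (f x) (f-true x))) ⟩
      toℕ (position x)  ≡⟨ cong toℕ eq ⟩
      toℕ (position y)  ≡⟨ toℕ-fromℕ< (rank<count b (f y) (f-true y)) ⟩
      rank b (f y)      ∎))
      where open Relation.Binary.PropositionalEquality.≡-Reasoning

  count-≤-injection : ∀ m {k} (b : Fin m → Bool) (g : ∀ j → T (b j) → Fin k) →
    (∀ j j' p p' → g j p ≡ g j' p' → j ≡ j') → count m b ≤ k
  count-≤-injection zero b g g-inj = z≤n
  count-≤-injection (suc m) b g g-inj with b fzero in b₀≡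
  ... | false = count-≤-injection m (b ∘ fsuc) (g ∘ fsuc) λ j j' p p' e → suc-injective (g-inj _ _ p p' e)
  ... | true  = first-true _ g g-inj
    where
    b₀ : T (b fzero)
    b₀ = subst T (sym b₀≡) _
    -- The image g₀ of the first entry is removed from Fin k by punchOut.
    first-true : ∀ k (g : ∀ j → T (b j) → Fin k) → (∀ j j' p p' → g j p ≡ g j' p' → j ≡ j') →
      1 + count m (b ∘ fsuc) ≤ k
    first-true zero    g g-inj with g fzero b₀
    ... | ()
    first-true (suc k) g g-inj = s≤s (count-≤-injection m (b ∘ fsuc) g' g'-inj)
      where
      g₀≢ : ∀ j p → ¬ (g fzero b₀ ≡ g (fsuc j) p)
      g₀≢ j p e with g-inj fzero (fsuc j) b₀ p e
      ... | ()
      g' : ∀ j → T (b (fsuc j)) → Fin k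
      g' j p = punchOut (g₀≢ j p)
      g'-inj : ∀ j j' p p' → g' j p ≡ g' j' p' → j ≡ j'
      g'-inj j j' p p' e = suc-injective (g-inj _ _ p p' (punchOut-injective (g₀≢ j p) (g₀≢ j' p') e))

  -- In one column: unless a holds, some entry of c is false, so
  --   count c + 1 ≤ [a] + t.
  column-bound : ∀ t (c : Fin t → Bool) a → ((∀ i → T (c i)) → T a) → count t c + 1 ≤ ind a + t
  column-bound t c a all⇒a with all? (λ i → T? (c i))
  ... | yes all-c = begin
    count t c + 1  ≡⟨ +-comm (count t c) 1 ⟩
    1 + count t c  ≤⟨ +-monoʳ-≤ 1 (count≤ t c) ⟩
    1 + t          ≡⟨ cong (_+ t) (sym (T⇒ind≡1 (all⇒a all-c))) ⟩
    ind a + t      ∎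
    where open Data.Nat.Properties.≤-Reasoning
  ... | no ¬all-c with ¬∀⟶∃¬ t _ (λ i → T? (c i)) ¬all-c
  ...   | i , ¬cᵢ = begin
    count t c + 1  ≡⟨ +-comm (count t c) 1 ⟩
    suc (count t c) ≤⟨ count< t c i ¬cᵢ ⟩
    t              ≤⟨ m≤n+m t (ind a) ⟩
    ind a + t      ∎
    where open Data.Nat.Properties.≤-Reasoning

  bonferroni : ∀ t m (b : Fin t → Fin m → Bool) (a : Fin m → Bool) →
    (∀ j → (∀ i → T (b i j)) → T (a j)) →
    sumℕ t (λ i → count m (b i)) + m ≤ count m a + t * m
  bonferroni t m b a all⇒a = begin
    sumℕ t (λ i → count m (b i)) + m
      ≡⟨ cong₂ _+_ (sumℕ-swap t m (λ i j → ind (b i j))) (sym (trans (sumℕ-const m 1) (*-identityʳ m))) ⟩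
    sumℕ m (λ j → count t (λ i → b i j)) + sumℕ m (λ _ → 1)
      ≡⟨ sym (sumℕ-+ m (λ j → count t (λ i → b i j)) (λ _ → 1)) ⟩
    sumℕ m (λ j → count t (λ i → b i j) + 1)
      ≤⟨ sumℕ-mono m (λ j → column-bound t (λ i → b i j) (a j) (all⇒a j)) ⟩
    sumℕ m (λ j → ind (a j) + t)
      ≡⟨ sumℕ-+ m (λ j → ind (a j)) (λ _ → t) ⟩
    count m a + sumℕ m (λ _ → t)
      ≡⟨ cong (count m a +_) (trans (sumℕ-const m t) (*-comm m t)) ⟩
    count m a + t * m ∎
    where open Data.Nat.Properties.≤-Reasoning

module FreeElements (F : CommutativeRing 0ℓ 0ℓ) where
  open CommutativeRing F
  open FieldDefs F
  open import Algebra.Properties.Semiring.Exp semiring using (_^_; ^-congˡ; ^-assocʳ)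
  open import Data.Nat.Base using (zero; suc) renaming (_*_ to _*ℕ_)
  open import Data.Nat.Properties using (_≟_)
  open import Data.Nat.Divisibility using (_∣_; divides; ∣-trans)
  open import Data.Nat.Primality using (Prime; ¬prime[1])
  open import Data.Product using (_,_)
  open import Relation.Nullary using (yes; no; contradiction)
  import Relation.Binary.PropositionalEquality as ≡
  open import Relation.Binary.Reasoning.Setoid setoid
  open DivisibilityFacts using (prime∣lcmFam; prime-divisor)

  pow≡^ : ∀ x d → pow x d ≡.≡ x ^ d
  pow≡^ x zero    = ≡.refl
  pow≡^ x (suc d) = ≡.cong (x *_) (pow≡^ x d)

  pow-congˡ : ∀ d {x y} → x ≈ y → pow x d ≈ pow y d
  pow-congˡ d {x} {y} x≈y = begin
    pow x d  ≡⟨ pow≡^ x d ⟩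
    x ^ d    ≈⟨ ^-congˡ d x≈y ⟩
    y ^ d    ≡⟨ pow≡^ y d ⟨
    pow y d  ∎

  pow-assoc : ∀ x c p → pow x (c *ℕ p) ≈ pow (pow x c) p
  pow-assoc x c p = begin
    pow x (c *ℕ p)  ≡⟨ pow≡^ x (c *ℕ p) ⟩
    x ^ (c *ℕ p)    ≈⟨ ^-assocʳ x c p ⟨
    (x ^ c) ^ p     ≡⟨ ≡.cong (_^ p) (pow≡^ x c) ⟨
    (pow x c) ^ p   ≡⟨ pow≡^ (pow x c) p ⟨
    pow (pow x c) p ∎

  Free-resp : ∀ {s x y} → x ≈ y → Free s x → Free s y
  Free-resp x≈y x-free d z d∣s y≈zᵈ = x-free d z d∣s (trans x≈y y≈zᵈ)

  Free-divisor : ∀ {s s' x} → s' ∣ s → Free s x → Free s' x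
  Free-divisor s'∣s x-free d z d∣s' = x-free d z (∣-trans d∣s' s'∣s)

  -- An element that is rᵢ-free for every i is lcm(r₁, …, r_t)-free: if
  -- x = yᵈ with d ≠ 1 dividing the lcm, a prime p ∣ d divides some rᵢ and
  -- x = (y^(d/p))ᵖ contradicts rᵢ-freeness.
  Free-lcm : ∀ t (rs : Fin t → ℕ) {x} → (∀ i → Free (rs i) x) → Free (lcmFam t rs) x
  Free-lcm t rs {x} free d y d∣lcm x≈yᵈ with d ≟ 1
  ... | yes d≡1 = d≡1
  ... | no d≢1 with prime-divisor d d≢1
  ...   | p , p-prime , divides c d≡cp with prime∣lcmFam t rs p-prime (∣-trans (divides c d≡cp) d∣lcm)
  ...     | i , p∣rᵢ = contradiction (free i p (pow y c) p∣rᵢ x≈[yᶜ]ᵖ) λ p≡1 → ¬prime[1] (≡.subst Prime p≡1 p-prime)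
    where
    x≈[yᶜ]ᵖ : x ≈ pow (pow y c) p
    x≈[yᶜ]ᵖ = begin
      x               ≈⟨ x≈yᵈ ⟩
      pow y d         ≡⟨ ≡.cong (pow y) d≡cp ⟩
      pow y (c *ℕ p)  ≈⟨ pow-assoc y c p ⟩
      pow (pow y c) p ∎

module FiniteRing (F : CommutativeRing 0ℓ 0ℓ) {N : ℕ} (enum : FieldDefs.HasOrder F N) where
  open CommutativeRing F
  open FieldDefs F
  open FreeElements F using (pow-congˡ)
  open import Data.Fin.Properties using (all?) renaming (_≟_ to _≟ᶠ_)
  open import Data.Nat.Base using (NonZero)
  open import Data.Nat.Properties using (_≟_)
  open import Data.Product using (proj₁; proj₂)
  open import Function.Bundles using (Bijection)
  open import Relation.Nullary using (Dec; yes; no)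
  open import Relation.Nullary.Decidable using (map′; _→-dec_)
  import Relation.Binary.PropositionalEquality as ≡
  open DivisibilityFacts using (all-divisors?)

  element : Fin N → Carrier
  element = Bijection.to enum

  index : Carrier → Fin N
  index x = proj₁ (Bijection.strictlySurjective enum x)

  element-index : ∀ x → element (index x) ≈ x
  element-index x = proj₂ (Bijection.strictlySurjective enum x)

  _≈?_ : ∀ x y → Dec (x ≈ y)
  x ≈? y with index x ≟ᶠ index y
  ... | yes i≡j = yes (trans (sym (element-index x)) (trans (reflexive (≡.cong element i≡j)) (element-index y)))
  ... | no i≢j  = no λ x≈y → i≢j (Bijection.injective enum (trans (element-index x) (trans x≈y (sym (element-index y)))))

  all-elements? : ∀ {Q : Carrier → Set} → (∀ {x y} → x ≈ y → Q x → Q y) →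
    (∀ x → Dec (Q x)) → Dec (∀ x → Q x)
  all-elements? Q-resp Q? =
    map′ (λ h x → Q-resp (element-index x) (h (index x))) (λ h i → h (element i)) (all? (Q? ∘ element))
    where open import Function.Base using (_∘_)

  Free? : ∀ s .{{_ : NonZero s}} x → Dec (Free s x)
  Free? s x = map′ (λ h d y d∣s → h d d∣s y) (λ free d d∣s y → free d y d∣s)
    (all-divisors? s λ d → all-elements? (λ y≈z h x≈zᵈ → h (trans x≈zᵈ (pow-congˡ d (sym y≈z))))
                                         (λ y → (x ≈? pow y d) →-dec (d ≟ 1)))

module Cardinality (F : CommutativeRing 0ℓ 0ℓ) where
  open CommutativeRing F
  open FieldDefs F
  open BooleanCounting using (count; injection-≤-count; count-≤-injection)
  open import Data.Bool.Base using (T)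
  open import Data.Nat.Base using (_≤_)
  open import Data.Product using (Σ; _×_; _,_; proj₁; proj₂)
  open import Function.Bundles using (Bijection)
  open import Relation.Nullary using (Dec)
  open import Relation.Nullary.Decidable using (isYes; toWitness; fromWitness)
  import Relation.Binary.PropositionalEquality as ≡

  module _ {P : Carrier → Set} {k : ℕ} (card : HasCard P k) where
    member : Fin k → Carrier
    member i = proj₁ (Bijection.to card i)

    member-P : ∀ i → P (member i)
    member-P i = proj₂ (Bijection.to card i)

    position : Σ Carrier P → Fin k
    position u = proj₁ (Bijection.strictlySurjective card u)

    member-position : ∀ u → member (position u) ≈ proj₁ u
    member-position u = proj₂ (Bijection.strictlySurjective card u)

    position-injective : ∀ u v → position u ≡.≡ position v → proj₁ u ≈ proj₁ v
    position-injective u v eq =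
      trans (sym (member-position u)) (trans (reflexive (≡.cong member eq)) (member-position v))

  countAlong : ∀ {Q m} → HasCard Q m → {D : Carrier → Set} → (∀ x → Dec (D x)) → ℕ
  countAlong {m = m} cardQ D? = count m (λ j → isYes (D? (member cardQ j)))

  card≤countAlong : ∀ {P Q D : Carrier → Set} {k m} (cardP : HasCard P k) (cardQ : HasCard Q m)
    (D? : ∀ x → Dec (D x)) → (∀ {x y} → x ≈ y → D x → D y) → (∀ x → P x → Q x × D x) →
    k ≤ countAlong cardQ D?
  card≤countAlong {k = k} {m} cardP cardQ D? D-resp P⊆Q∩D =
    injection-≤-count (λ j → isYes (D? (member cardQ j))) into-Q into-Q-injective into-Q-satisfies-D
    where
    into-Q : Fin k → Fin m
    into-Q i = position cardQ (member cardP i , proj₁ (P⊆Q∩D _ (member-P cardP i)))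
    into-Q-injective : ∀ {i j} → into-Q i ≡.≡ into-Q j → i ≡.≡ j
    into-Q-injective eq = Bijection.injective cardP (position-injective cardQ _ _ eq)
    into-Q-satisfies-D : ∀ i → T (isYes (D? (member cardQ (into-Q i))))
    into-Q-satisfies-D i =
      fromWitness (D-resp (sym (member-position cardQ _)) (proj₂ (P⊆Q∩D _ (member-P cardP i))))

  countAlong≤card : ∀ {P Q D : Carrier → Set} {k m} (cardP : HasCard P k) (cardQ : HasCard Q m)
    (D? : ∀ x → Dec (D x)) → (∀ x → Q x → D x → P x) → countAlong cardQ D? ≤ k
  countAlong≤card {k = k} {m} cardP cardQ D? Q∩D⊆P =
    count-≤-injection m _ into-P λ i j _ _ eq → Bijection.injective cardQ (position-injective cardP _ _ eq)
    where
    into-P : ∀ j → T (isYes (D? (member cardQ j))) → Fin k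
    into-P j d = position cardP (member cardQ j , Q∩D⊆P _ (member-P cardQ j) (toWitness d))

module CompletelyNormalCounting (F : CommutativeRing 0ℓ 0ℓ) {N : ℕ} (enum : FieldDefs.HasOrder F N) where
  open FieldDefs F
  open FreeElements F using (Free-resp; Free-divisor; Free-lcm)
  open FiniteRing F enum using (Free?)
  open Cardinality F using (member; countAlong; card≤countAlong; countAlong≤card)
  open BooleanCounting using (bonferroni)
  open FinSums using (sumℕ-mono)
  open import Data.Nat.Base using (_+_; _*_; _≤_; NonZero)
  open import Data.Nat.Properties using (+-monoˡ-≤; module ≤-Reasoning)
  open import Data.Nat.Divisibility using (_∣_)
  open import Data.Product using (_,_)
  open import Data.Bool.Base using (T)
  open import Relation.Nullary using (Dec)
  open import Relation.Nullary.Decidable using (isYes; toWitness; fromWitness)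
  open import Relation.Binary.PropositionalEquality using (_≡_; subst)

  inclusion-exclusion-bound : ∀ q n t r r₀ (rs : Fin t → ℕ) .{{_ : NonZero r}} →
    (nz : ∀ i → NonZero (rs i)) → (∀ i → r₀ ∣ rs i) → lcmFam t rs ≡ r →
    ∀ {k k₀} {ks : Fin t → ℕ} → HasCard (CNPred q n r) k → HasCard (CNPred q n r₀) k₀ →
    (∀ i → HasCard (CNPred q n (rs i)) (ks i)) → sumℕ t ks + k₀ ≤ k + t * k₀
  inclusion-exclusion-bound q n t r r₀ rs nz r₀∣rᵢ lcm≡r {k} {k₀} {ks} card card₀ cards = begin
    sumℕ t ks + k₀
      ≤⟨ +-monoˡ-≤ k₀ (sumℕ-mono t λ i →
           card≤countAlong (cards i) card₀ (Free?ᵢ i) Free-resp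
             λ _ (x-free , x-normal) → (Free-divisor (r₀∣rᵢ i) x-free , x-normal) , x-free) ⟩
    sumℕ t (λ i → countAlong card₀ (Free?ᵢ i)) + k₀
      ≤⟨ bonferroni t k₀ _ _ all-free⇒r-free ⟩
    countAlong card₀ (Free? r) + t * k₀
      ≤⟨ +-monoˡ-≤ (t * k₀) (countAlong≤card card card₀ (Free? r) λ _ (_ , x-normal) x-free → x-free , x-normal) ⟩
    k + t * k₀ ∎
    where
    open ≤-Reasoning
    Free?ᵢ : ∀ i x → Dec (Free (rs i) x)
    Free?ᵢ i = Free? (rs i) {{nz i}}
    all-free⇒r-free : ∀ j → (∀ i → T (isYes (Free?ᵢ i (member card₀ j)))) →
      T (isYes (Free? r (member card₀ j)))
    all-free⇒r-free j all-free =
      fromWitness (subst (λ s → Free s (member card₀ j)) lcm≡r (Free-lcm t rs λ i → toWitness (all-free i)))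

module IntegerForm where
  open import Data.Integer.Base using (+_; +≤+; _+_; -_; _-_; _*_; _≤_)
  open import Data.Integer.Properties using (pos-+; pos-*; +-monoˡ-≤; module ≤-Reasoning)
  open import Data.Integer.Tactic.RingSolver using (solve-∀)
  import Data.Nat.Base as ℕ
  open import Relation.Binary.PropositionalEquality using (_≡_; cong; cong₂; sym)

  integer-form : ∀ S k t c → S ℕ.+ c ℕ.≤ k ℕ.+ t ℕ.* c → (+ S) - (+ t - + 1) * (+ c) ≤ + k
  integer-form S k t c S+c≤k+tc = begin
    + S - (+ t - + 1) * + c          ≡⟨ rearrange (+ S) (+ t) (+ c) ⟩
    (+ S + + c) - + t * + c          ≡⟨ cong₂ _-_ (sym (pos-+ S c)) (sym (pos-* t c)) ⟩
    + (S ℕ.+ c) - + (t ℕ.* c)        ≤⟨ +-monoˡ-≤ (- + (t ℕ.* c)) (+≤+ S+c≤k+tc) ⟩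
    + (k ℕ.+ t ℕ.* c) - + (t ℕ.* c)  ≡⟨ cong (_- + (t ℕ.* c)) (pos-+ k (t ℕ.* c)) ⟩
    + k + + (t ℕ.* c) - + (t ℕ.* c)  ≡⟨ cancel (+ k) (+ (t ℕ.* c)) ⟩
    + k                              ∎
    where
    open ≤-Reasoning
    rearrange : ∀ s t c → s - (t - + 1) * c ≡ (s + c) - t * c
    rearrange = solve-∀
    cancel : ∀ k u → k + u - u ≡ k
    cancel = solve-∀

open import Data.Nat using (_∸_; _^_; _≥_; NonZero; ≢-nonZero)
open import Data.Nat.Divisibility using (_∣_; ∣-trans)
open import Data.Nat.GCD using (gcd)
open import Data.Integer using (+_; _-_; _*_) renaming (_≥_ to _≥ℤ_)
open import Data.Product using (_,_)
open import Relation.Nullary using (¬_)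
open import Relation.Binary.PropositionalEquality using (_≡_)
open DivisibilityFacts using (common-divisor; divisor-nonzero; prime-power-pred≢0)
open IntegerForm using (integer-form)

proposition3 : (q n : ℕ) → IsPrimePower q → n ≥ 1 →
    (F : CommutativeRing 0ℓ 0ℓ) → FieldDefs.IsField F → FieldDefs.HasOrder F (q ^ n) →
    (q' r : ℕ) → IsSquareFreePart (q ^ n ∸ 1) q' → r ∣ q' →
    (t : ℕ) (r₀ : ℕ) (rs : Fin t → ℕ) →
    r₀ ∣ r → (∀ i → rs i ∣ r) →
    (∀ i j → ¬ (i ≡ j) → gcd (rs i) (rs j) ≡ r₀) →
    lcmFam t rs ≡ r →
    (k k₀ : ℕ) (ks : Fin t → ℕ) →
    FieldDefs.CNIs F q n r k → FieldDefs.CNIs F q n r₀ k₀ →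
    (∀ i → FieldDefs.CNIs F q n (rs i) (ks i)) →
    (+ k) ≥ℤ ((+ sumℕ t ks) - (+ t - + 1) * (+ k₀))
proposition3 q n q-prime-power n≥1 F _ enum q' r (_ , q'∣qⁿ∸1 , _) r∣q' t r₀ rs r₀∣r rᵢ∣r gcd≡r₀ lcm≡r
             k k₀ ks card card₀ cards =
  integer-form (sumℕ t ks) k t k₀
    (inclusion-exclusion-bound q n t r r₀ rs {{≢-nonZero r≢0}} rᵢ≢0
      (common-divisor t rs r₀∣r gcd≡r₀ lcm≡r) lcm≡r card card₀ cards)
  where
  open CompletelyNormalCounting F enum using (inclusion-exclusion-bound)
  -- r and all rᵢ are nonzero, since they divide qⁿ − 1 ≠ 0.
  r≢0 : ¬ (r ≡ 0)
  r≢0 = divisor-nonzero (∣-trans r∣q' q'∣qⁿ∸1) (prime-power-pred≢0 q-prime-power n≥1)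
  rᵢ≢0 : ∀ i → NonZero (rs i)
  rᵢ≢0 i = ≢-nonZero (divisor-nonzero (rᵢ∣r i) r≢0)
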